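{- Let $c\ge 1$ and let $I=(G,X,k)$ be an instance of a-$c$-tdmod-IS with $G=(V,E,\mathcal{H})$, $R=V\setminus X$. Suppose $R'$ is the vertex set of a connected component of $G[R]$ such that ${\sf conf}_{R'}(X')=0$ for every $X' \in \mathcal{X}$. Let $I'$ be the instance obtained from $I$ by deleting $R'$ (and all incident edges) and replacing $k$ by $k-\alpha(R')$. Then $I$ and $I'$ are equivalent.
   Context: Treedepth ${\sf td}$: minimum height of a rooted forest whose closure (each vertex joined to all ancestors) contains the graph. An instance of a-$c$-tdmod-IS is $(G,X,k)$ where $G=(V,E,\mathcal{H})$ with $V=X\uplus R$, $E$ a set of 2-element edges each with one endpoint in $X$ and one in $R$ or both in $R$, $\mathcal{H}$ a set of hyperedges each contained in $X$, ${\sf td}(G[R])\le c$, and $k$ an integer; the question is whether $\alpha(G)\ge k$, where an independent set is a set $S\subseteq V$ with $h\not\subseteq S$ for all $h\in E\cup\mathcal{H}$ and $\alpha$ is the maximum size of one. Equivalent instances have the same answer. For $R'\subseteq R$, $\alpha(R')$ is the independence number of $G[R']$; for $X'\subseteq X$, $N_{R'}(X')=\{v\in R' : \exists x\in X', \{x,v\}\in E\}$ and ${\sf conf}_{R'}(X')=\alpha(R')-\alpha(R'\setminus N_{R'}(X'))$. The set of chunks is $\mathcal{X}=\{X'\subseteq X : 0<|X'|\le 2^c \text{ and no } H\in\mathcal{H} \text{ satisfies } H\subseteq X'\}$. -}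

module Defs where

open import Data.Nat using (ℕ; zero; suc; _≤_; _<_; _^_; _⊔_)
open import Data.Integer as ℤ using (ℤ; +_; 0ℤ)
open import Data.Fin using (Fin)
open import Data.Fin.Properties using () renaming (_≟_ to _≟ᶠ_; any? to anyFin?)
open import Data.Fin.Subset
  using (Subset; inside; outside; _∈_; _∉_; _⊆_; _─_; ∣_∣; Nonempty)
open import Data.Fin.Subset.Properties using (_∈?_; _⊆?_)
open import Data.Vec using ([]; _∷_; tabulate)
open import Data.List using (List; []; _∷_; _++_; map; filter; foldr)
open import Data.List.Relation.Unary.All using (All; all?)
open import Data.List.Relation.Unary.Any using (Any; any?)
open import Data.List.Membership.Propositional using () renaming (_∈_ to _∈ˡ_)
open import Data.Maybe using (Maybe; just; nothing)
open import Data.Product using (Σ; ∃; _×_; _,_; proj₁; proj₂)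
open import Data.Product.Properties using (≡-dec)
open import Data.Sum using (_⊎_)
open import Relation.Nullary using (¬_; Dec; yes; no; ¬?)
open import Relation.Nullary.Decidable using (⌊_⌋; _×-dec_; _⊎-dec_)
open import Relation.Binary.PropositionalEquality using (_≡_; _≢_)
open import Function.Bundles using (_⇔_)

-- Vertices live in Fin n; the vertex set of the graph is the
-- subset V (so that deleting vertices is just shrinking V).
-- Edges are ordered pairs read as 2-element sets {u , v};
-- hyperedges are subsets of Fin n.

record Instance (n : ℕ) : Set where
  field
    V : Subset n
    X : Subset n
    E : List (Fin n × Fin n)
    H : List (Subset n)
    k : ℤ

  R : Subset n
  R = V ─ X

open Instance public

-- Treedepth of G[W] ≤ c (edges of E inside W; hyperedges are irrelevant
-- for treedepth, and inside R only the degenerate empty hyperedge could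
-- occur).
-- A rooted forest on W is given by a parent map; depth v is the number of
-- vertices on the path from v to its root (roots have depth 1), which also
-- guarantees acyclicity.

data Anc {n : ℕ} (par : Fin n → Maybe (Fin n)) : Fin n → Fin n → Set where
  self : ∀ {v} → Anc par v v
  up   : ∀ {u v w} → par v ≡ just w → Anc par u w → Anc par u v

record ForestOfHeight≤ {n : ℕ} (E : List (Fin n × Fin n)) (W : Subset n)
                       (c : ℕ) : Set where
  field
    par     : Fin n → Maybe (Fin n)
    depth   : Fin n → ℕ
    depth≥1 : ∀ v → v ∈ W → 1 ≤ depth v
    depth≤c : ∀ v → v ∈ W → depth v ≤ c
    par-in  : ∀ v w → v ∈ W → par v ≡ just w → w ∈ W
    par-dep : ∀ v w → v ∈ W → par v ≡ just w → depth v ≡ suc (depth w)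
    root-dep : ∀ v → v ∈ W → par v ≡ nothing → depth v ≡ 1
    -- the closure of the forest contains G[W]
    closure : ∀ u v → (u , v) ∈ˡ E → u ∈ W → v ∈ W → Anc par u v ⊎ Anc par v u

td≤ : ∀ {n} → List (Fin n × Fin n) → Subset n → ℕ → Set
td≤ E W c = ForestOfHeight≤ E W c

record IsInstance {n : ℕ} (c : ℕ) (I : Instance n) : Set where
  field
    X⊆V   : X I ⊆ V I
    edge-2 : ∀ u v → (u , v) ∈ˡ E I → u ≢ v
    edge-V : ∀ u v → (u , v) ∈ˡ E I → u ∈ V I × v ∈ V I
    edge-XR : ∀ u v → (u , v) ∈ˡ E I →
              (u ∈ X I × v ∈ R I) ⊎ (u ∈ R I × v ∈ X I) ⊎ (u ∈ R I × v ∈ R I)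
    hyp-X : ∀ h → h ∈ˡ H I → h ⊆ X I
    td-R  : td≤ (E I) (R I) c

IndepE : ∀ {n} → List (Fin n × Fin n) → Subset n → Set
IndepE E S = All (λ e → ¬ (proj₁ e ∈ S × proj₂ e ∈ S)) E

IndepH : ∀ {n} → List (Subset n) → Subset n → Set
IndepH H S = All (λ h → ¬ (h ⊆ S)) H

Indep : ∀ {n} → Instance n → Subset n → Set
Indep I S = S ⊆ V I × IndepE (E I) S × IndepH (H I) S

IndepIn : ∀ {n} → Instance n → Subset n → Subset n → Set
IndepIn I W S = S ⊆ W × Indep I S

IndepIn? : ∀ {n} (I : Instance n) (W S : Subset n) → Dec (IndepIn I W S)
IndepIn? I W S =
  (S ⊆? W) ×-dec ((S ⊆? V I)
    ×-dec (all? (λ e → ¬? ((proj₁ e ∈? S) ×-dec (proj₂ e ∈? S))) (E I)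
    ×-dec  all? (λ h → ¬? (h ⊆? S)) (H I)))

allSubsets : ∀ n → List (Subset n)
allSubsets zero = [] ∷ []
allSubsets (suc n) = map (inside ∷_) s ++ map (outside ∷_) s
  where s = allSubsets n

maximum : List ℕ → ℕ
maximum = foldr _⊔_ 0

α : ∀ {n} → Instance n → Subset n → ℕ
α {n} I W = maximum (map ∣_∣ (filter (IndepIn? I W) (allSubsets n)))

Yes : ∀ {n} → Instance n → Set
Yes I = ∃ λ S → Indep I S × (k I ℤ.≤ + ∣ S ∣)

Equivalent : ∀ {n m} → Instance n → Instance m → Set
Equivalent I J = Yes I ⇔ Yes J

data Reach {n : ℕ} (E : List (Fin n × Fin n)) (W : Subset n) :
           Fin n → Fin n → Set where
  here : ∀ {v} → Reach E W v v
  step : ∀ {u v w} → Reach E W u v → v ∈ W → w ∈ W →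
         ((v , w) ∈ˡ E ⊎ (w , v) ∈ˡ E) → Reach E W u w

IsComponent : ∀ {n} → List (Fin n × Fin n) → Subset n → Subset n → Set
IsComponent E W C =
  C ⊆ W × Nonempty C ×
  (∀ u v → u ∈ C → v ∈ C → Reach E W u v) ×
  (∀ u v → u ∈ C → Reach E W u v → v ∈ C)

Adj : ∀ {n} → List (Fin n × Fin n) → Fin n → Fin n → Set
Adj E x v = Any (λ e → (e ≡ (x , v)) ⊎ (e ≡ (v , x))) E

Adj? : ∀ {n} (E : List (Fin n × Fin n)) x v → Dec (Adj E x v)
Adj? E x v = any? (λ e → (≡-dec _≟ᶠ_ _≟ᶠ_ e (x , v)) ⊎-dec (≡-dec _≟ᶠ_ _≟ᶠ_ e (v , x))) E

N : ∀ {n} → Instance n → Subset n → Subset n → Subset n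
N I R′ X′ = tabulate (λ v →
  ⌊ (v ∈? R′) ×-dec anyFin? (λ x → (x ∈? X′) ×-dec Adj? (E I) x v) ⌋)

conf : ∀ {n} → Instance n → Subset n → Subset n → ℤ
conf I R′ X′ = + α I R′ ℤ.- + α I (R′ ─ N I R′ X′)

IsChunk : ∀ {n} → ℕ → Instance n → Subset n → Set
IsChunk c I X′ =
  X′ ⊆ X I × 0 < ∣ X′ ∣ × ∣ X′ ∣ ≤ 2 ^ c × All (λ h → ¬ (h ⊆ X′)) (H I)

touches : ∀ {n} (C : Subset n) (e : Fin n × Fin n) → Dec (proj₁ e ∈ C ⊎ proj₂ e ∈ C)
touches C e = (proj₁ e ∈? C) ⊎-dec (proj₂ e ∈? C)

delete : ∀ {n} → Instance n → Subset n → Instance n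
delete I C = record
  { V = V I ─ C
  ; X = X I
  ; E = filter (λ e → ¬? (touches C e)) (E I)
  ; H = H I
  ; k = k I ℤ.- + α I C
  }

module Submission where

-- Deleting R′ loses at most α(R′) vertices of an independent set S of G.
-- Conversely, if S′ is independent in the reduced instance and Y = S′ ∩ X,
-- any independent set of R′ ∖ N(Y) can be added to S′, so it suffices that
-- α(R′ ∖ N(Y)) = α(R′).  This follows from the small-witness lemma: if
-- α(Z ∖ N(Y)) < α(Z) for Z ⊆ R whose forest depths lie in a window of
-- width d, then some Y′ ⊆ Y with |Y′| ≤ 2^d already has α(Z ∖ N(Y′)) < α(Z).
-- It is proved by induction on d and then on |Z|: Z splits into the
-- non-adjacent subtree A below a shallowest vertex r and the rest; in A the
-- branching recurrence α(A) = max(α(A − r), 1 + α(A − N[r])) leads to two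
-- sets of width d, whose witnesses are united.  For Z = R′ (width c) the
-- witness would be a chunk of nonzero conflict.

open import Defs
open import Data.Nat using (ℕ; _≤_)
open import Data.Fin.Subset using (Subset)
open import Data.Integer using (0ℤ)
open import Relation.Binary.PropositionalEquality using (_≡_)

open import Data.Bool.Properties using (T-≡)
open import Data.Empty using (⊥; ⊥-elim)
open import Data.Fin using (Fin)
open import Data.Fin.Properties using () renaming (_≟_ to _≟ᶠ_; any? to anyFin?)
open import Data.Fin.Subset
  using (_∈_; _∉_; _⊆_; _─_; _-_; _∪_; _∩_; ⁅_⁆; ∣_∣; Nonempty; inside; outside)
  renaming (⊥ to ∅)
open import Data.Fin.Subset.Properties
  using ( _∈?_; nonempty?; Empty-unique; ∉⊥; ∣⊥∣≡0; x∈⁅x⁆; x∈⁅y⁆⇒x≡y; ∣⁅x⁆∣≡1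
        ; p⊆q⇒∣p∣≤∣q∣; p⊂q⇒∣p∣<∣q∣; x∈p∪q⁻; x∈p∪q⁺; p⊆p∪q; q⊆p∪q
        ; x∈p∩q⁺; x∈p∩q⁻; p─q⊆p; p∩q⊆p; p∩q⊆q; x∈p∧x∉q⇒x∈p─q; x∈p∧x≢y⇒x∈p-y )
open import Data.Integer as ℤ using (ℤ)
import Data.Integer.Properties as ℤₚ
open import Data.List using (List; []; _∷_; map; filter)
open import Data.List.Membership.Propositional using () renaming (_∈_ to _∈ˡ_)
open import Data.List.Membership.Propositional.Properties
  using (∈-map⁺; ∈-map⁻; ∈-filter⁺; ∈-filter⁻; ∈-++⁺ˡ; ∈-++⁺ʳ)
open import Data.List.Relation.Unary.All as All using (All)
import Data.List.Relation.Unary.All.Properties as Allₚ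
import Data.List.Relation.Unary.Any as Any
open import Data.Maybe using (just; nothing)
open import Data.Nat using (zero; suc; _<_; _+_; _^_; _⊔_; z≤n; s≤s)
open import Data.Nat.Induction using (<-wellFounded)
open import Data.Nat.Properties
  using ( ≤-refl; ≤-trans; ≤-antisym; ≤-reflexive; <-≤-trans; ≤-<-trans; <-irrefl; <-trans; <⇒≱; ≮⇒≥; _<?_
        ; n≮0; +-suc; +-identityʳ; +-monoʳ-≤; +-monoˡ-≤; +-mono-≤; n≤1+n; +-cancelˡ-<
        ; +-monoʳ-<; +-mono-<-≤; m≤m⊔n; m≤n⊔m; ⊔-lub; ⊔-sel; m^n>0; ≤-pred; module ≤-Reasoning )
open import Data.Product using (∃; _×_; _,_; proj₁; proj₂)
open import Data.Sum using (_⊎_; inj₁; inj₂; swap; [_,_]) renaming (map to map-⊎)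
open import Data.Vec using (_∷_; []; tabulate; here; there)
open import Data.Vec.Properties using (lookup∘tabulate; []=⇒lookup; lookup⇒[]=)
open import Function.Bundles using (Equivalence; mk⇔)
open import Induction.WellFounded using (Acc; acc)
open import Relation.Nullary using (¬_; Dec; yes; no; ¬?)
open import Relation.Nullary.Decidable using (⌊_⌋; toWitness; fromWitness; _×-dec_; map′)
open import Relation.Unary using (Decidable)
open import Relation.Binary.PropositionalEquality using (_≢_; refl; sym; trans; cong; subst)

select : ∀ {n} {P : Fin n → Set} → Decidable P → Subset n
select P? = tabulate (λ v → ⌊ P? v ⌋)

select⁺ : ∀ {n} {P : Fin n → Set} (P? : Decidable P) {x} → P x → x ∈ select P?
select⁺ P? {x} p =
  lookup⇒[]= x _ (trans (lookup∘tabulate (λ v → ⌊ P? v ⌋) x)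
                        (Equivalence.to T-≡ (fromWitness p)))

select⁻ : ∀ {n} {P : Fin n → Set} (P? : Decidable P) {x} → x ∈ select P? → P x
select⁻ P? {x} x∈ =
  toWitness (Equivalence.from T-≡
    (trans (sym (lookup∘tabulate (λ v → ⌊ P? v ⌋) x)) ([]=⇒lookup x∈)))

x∈p─q⇒x∉q : ∀ {n} (p q : Subset n) {x} → x ∈ p ─ q → x ∉ q
x∈p─q⇒x∉q (_ ∷ _) (inside ∷ _) () here
x∈p─q⇒x∉q (_ ∷ p) (_ ∷ q) (there x∈) (there x∈q) = x∈p─q⇒x∉q p q x∈ x∈q

x∈p-y⇒x≢y : ∀ {n} (p : Subset n) {x y} → x ∈ p - y → x ≢ y
x∈p-y⇒x≢y p {y = y} x∈ refl = x∈p─q⇒x∉q p ⁅ y ⁆ x∈ (x∈⁅x⁆ y)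

∣p∪q∣≤∣p∣+∣q∣ : ∀ {n} (p q : Subset n) → ∣ p ∪ q ∣ ≤ ∣ p ∣ + ∣ q ∣
∣p∪q∣≤∣p∣+∣q∣ []            []            = z≤n
∣p∪q∣≤∣p∣+∣q∣ (outside ∷ p) (outside ∷ q) = ∣p∪q∣≤∣p∣+∣q∣ p q
∣p∪q∣≤∣p∣+∣q∣ (outside ∷ p) (inside ∷ q)  =
  ≤-trans (s≤s (∣p∪q∣≤∣p∣+∣q∣ p q)) (≤-reflexive (sym (+-suc ∣ p ∣ ∣ q ∣)))
∣p∪q∣≤∣p∣+∣q∣ (inside ∷ p)  (outside ∷ q) = s≤s (∣p∪q∣≤∣p∣+∣q∣ p q)
∣p∪q∣≤∣p∣+∣q∣ (inside ∷ p)  (inside ∷ q)  =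
  s≤s (≤-trans (∣p∪q∣≤∣p∣+∣q∣ p q) (+-monoʳ-≤ ∣ p ∣ (n≤1+n ∣ q ∣)))

disjoint⇒∣p∣+∣q∣≤∣p∪q∣ : ∀ {n} (p q : Subset n) → (∀ {x} → x ∈ p → x ∉ q) →
                         ∣ p ∣ + ∣ q ∣ ≤ ∣ p ∪ q ∣
disjoint⇒∣p∣+∣q∣≤∣p∪q∣ [] [] _ = z≤n
disjoint⇒∣p∣+∣q∣≤∣p∪q∣ (outside ∷ p) (outside ∷ q) dj =
  disjoint⇒∣p∣+∣q∣≤∣p∪q∣ p q (λ x∈p x∈q → dj (there x∈p) (there x∈q))
disjoint⇒∣p∣+∣q∣≤∣p∪q∣ (outside ∷ p) (inside ∷ q) dj =
  ≤-trans (≤-reflexive (+-suc ∣ p ∣ ∣ q ∣))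
          (s≤s (disjoint⇒∣p∣+∣q∣≤∣p∪q∣ p q (λ x∈p x∈q → dj (there x∈p) (there x∈q))))
disjoint⇒∣p∣+∣q∣≤∣p∪q∣ (inside ∷ p) (outside ∷ q) dj =
  s≤s (disjoint⇒∣p∣+∣q∣≤∣p∪q∣ p q (λ x∈p x∈q → dj (there x∈p) (there x∈q)))
disjoint⇒∣p∣+∣q∣≤∣p∪q∣ (inside ∷ p) (inside ∷ q) dj = ⊥-elim (dj here here)

∪-⊆ : ∀ {n} {p q r : Subset n} → p ⊆ r → q ⊆ r → p ∪ q ⊆ r
∪-⊆ {p = p} {q} p⊆r q⊆r x∈ with x∈p∪q⁻ p q x∈
... | inj₁ x∈p = p⊆r x∈p
... | inj₂ x∈q = q⊆r x∈q

card-pos : ∀ {n} (p : Subset n) {x} → x ∈ p → 0 < ∣ p ∣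
card-pos p {x} x∈p = ≤-trans (≤-reflexive (sym (∣⁅x⁆∣≡1 x)))
                             (p⊆q⇒∣p∣≤∣q∣ λ y∈ → subst (_∈ p) (sym (x∈⁅y⁆⇒x≡y x y∈)) x∈p)

card-nonempty : ∀ {n} (p : Subset n) → 0 < ∣ p ∣ → Nonempty p
card-nonempty {n} p pos with nonempty? p
... | yes ne = ne
... | no empty = ⊥-elim (<-irrefl refl (<-≤-trans pos
                   (≤-reflexive (trans (cong ∣_∣ (Empty-unique empty)) (∣⊥∣≡0 n)))))

∣p∣≤1+∣p-x∣ : ∀ {n} (p : Subset n) x → ∣ p ∣ ≤ suc ∣ p - x ∣
∣p∣≤1+∣p-x∣ p x = begin
  ∣ p ∣               ≤⟨ p⊆q⇒∣p∣≤∣q∣ (λ y∈ → x∈p∪q⁺ (x-or-rest y∈)) ⟩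
  ∣ ⁅ x ⁆ ∪ (p - x) ∣ ≤⟨ ∣p∪q∣≤∣p∣+∣q∣ ⁅ x ⁆ (p - x) ⟩
  ∣ ⁅ x ⁆ ∣ + ∣ p - x ∣ ≡⟨ cong (_+ ∣ p - x ∣) (∣⁅x⁆∣≡1 x) ⟩
  suc ∣ p - x ∣       ∎
  where
  open ≤-Reasoning
  x-or-rest : ∀ {y} → y ∈ p → y ∈ ⁅ x ⁆ ⊎ y ∈ p - x
  x-or-rest {y} y∈ with y ≟ᶠ x
  ... | yes refl = inj₁ (x∈⁅x⁆ x)
  ... | no y≢x   = inj₂ (x∈p∧x≢y⇒x∈p-y y∈ y≢x)

argmin : ∀ {n} (f : Fin n → ℕ) (U : Subset n) → Nonempty U →
         ∃ λ r → r ∈ U × (∀ {u} → u ∈ U → f r ≤ f u)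
argmin f U (x , x∈) = go x x∈ (<-wellFounded (f x))
  where
  go : ∀ x → x ∈ U → Acc _<_ (f x) → ∃ λ r → r ∈ U × (∀ {u} → u ∈ U → f r ≤ f u)
  go x x∈ (acc smaller) with anyFin? (λ u → (u ∈? U) ×-dec (f u <? f x))
  ... | yes (u , u∈ , fu<fx) = go u u∈ (smaller fu<fx)
  ... | no none              = x , x∈ , λ u∈ → ≮⇒≥ (λ fu<fx → none (_ , u∈ , fu<fx))

double : ∀ {a b} d → a ≤ 2 ^ d → b ≤ 2 ^ d → a + b ≤ 2 ^ suc d
double d a≤ b≤ rewrite +-identityʳ (2 ^ d) = +-mono-≤ a≤ b≤

allSubsets-complete : ∀ n (p : Subset n) → p ∈ˡ allSubsets n
allSubsets-complete zero    []           = Any.here refl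
allSubsets-complete (suc n) (inside ∷ p)  =
  ∈-++⁺ˡ (∈-map⁺ (inside ∷_) (allSubsets-complete n p))
allSubsets-complete (suc n) (outside ∷ p) =
  ∈-++⁺ʳ (map (inside ∷_) (allSubsets n)) (∈-map⁺ (outside ∷_) (allSubsets-complete n p))

≤-maximum : ∀ {x xs} → x ∈ˡ xs → x ≤ maximum xs
≤-maximum {xs = y ∷ ys} (Any.here refl) = m≤m⊔n y (maximum ys)
≤-maximum {xs = y ∷ ys} (Any.there x∈) = ≤-trans (≤-maximum x∈) (m≤n⊔m y (maximum ys))

maximum-attained : ∀ xs → maximum xs ≡ 0 ⊎ maximum xs ∈ˡ xs
maximum-attained []       = inj₁ refl
maximum-attained (x ∷ xs) with ⊔-sel x (maximum xs)
... | inj₁ max≡x = inj₂ (Any.here max≡x)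
... | inj₂ max≡rest with maximum-attained xs
...   | inj₁ rest≡0 = inj₁ (trans max≡rest rest≡0)
...   | inj₂ rest∈  = inj₂ (subst (_∈ˡ x ∷ xs) (sym max≡rest) (Any.there rest∈))

NoEdge : ∀ {n} → List (Fin n × Fin n) → Subset n → Subset n → Set
NoEdge Es A B = ∀ {u v} → (u , v) ∈ˡ Es → u ∈ A → v ∈ B → ⊥

IndepE-mono : ∀ {n} {Es : List (Fin n × Fin n)} {S T} → S ⊆ T → IndepE Es T → IndepE Es S
IndepE-mono S⊆T = All.map (λ ¬both both → ¬both (S⊆T (proj₁ both) , S⊆T (proj₂ both)))

IndepH-mono : ∀ {n} {Hs : List (Subset n)} {S T} → S ⊆ T → IndepH Hs T → IndepH Hs S
IndepH-mono S⊆T = All.map (λ ¬h⊆T h⊆S → ¬h⊆T (λ x∈ → S⊆T (h⊆S x∈)))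

IndepE-∪ : ∀ {n} {Es : List (Fin n × Fin n)} {S T} → IndepE Es S → IndepE Es T →
           NoEdge Es S T → NoEdge Es T S → IndepE Es (S ∪ T)
IndepE-∪ {Es = Es} {S} {T} indS indT noST noTS = All.tabulate no-edge
  where
  no-edge : ∀ {e} → e ∈ˡ Es → ¬ (proj₁ e ∈ S ∪ T × proj₂ e ∈ S ∪ T)
  no-edge {u , v} e∈ (u∈ , v∈) with x∈p∪q⁻ S T u∈ | x∈p∪q⁻ S T v∈
  ... | inj₁ u∈S | inj₁ v∈S = All.lookup indS e∈ (u∈S , v∈S)
  ... | inj₂ u∈T | inj₂ v∈T = All.lookup indT e∈ (u∈T , v∈T)
  ... | inj₁ u∈S | inj₂ v∈T = noST e∈ u∈S v∈T
  ... | inj₂ u∈T | inj₁ v∈S = noTS e∈ u∈T v∈S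

Adj⇒edge : ∀ {n} {Es : List (Fin n × Fin n)} {x v} → Adj Es x v → (x , v) ∈ˡ Es ⊎ (v , x) ∈ˡ Es
Adj⇒edge (Any.here (inj₁ refl)) = inj₁ (Any.here refl)
Adj⇒edge (Any.here (inj₂ refl)) = inj₂ (Any.here refl)
Adj⇒edge (Any.there adj) with Adj⇒edge adj
... | inj₁ e∈ = inj₁ (Any.there e∈)
... | inj₂ e∈ = inj₂ (Any.there e∈)

edge⇒Adj : ∀ {n} {Es : List (Fin n × Fin n)} {x v} → (x , v) ∈ˡ Es ⊎ (v , x) ∈ˡ Es → Adj Es x v
edge⇒Adj (inj₁ (Any.here refl)) = Any.here (inj₁ refl)
edge⇒Adj (inj₂ (Any.here refl)) = Any.here (inj₂ refl)
edge⇒Adj (inj₁ (Any.there e∈)) = Any.there (edge⇒Adj (inj₁ e∈))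
edge⇒Adj (inj₂ (Any.there e∈)) = Any.there (edge⇒Adj (inj₂ e∈))

Indep-adj : ∀ {n} {Es : List (Fin n × Fin n)} {S u v} → IndepE Es S → u ∈ S → v ∈ S → ¬ Adj Es u v
Indep-adj ind u∈ v∈ adj with Adj⇒edge adj
... | inj₁ e∈ = All.lookup ind e∈ (u∈ , v∈)
... | inj₂ e∈ = All.lookup ind e∈ (v∈ , u∈)

record Split {n} (Es : List (Fin n × Fin n)) (W A B : Subset n) : Set where
  field
    A⊆W      : A ⊆ W
    B⊆W      : B ⊆ W
    covers   : W ⊆ A ∪ B
    disjoint : ∀ {v} → v ∈ A → v ∉ B
    noEdgeAB : NoEdge Es A B
    noEdgeBA : NoEdge Es B A

Split-swap : ∀ {n} {Es : List (Fin n × Fin n)} {W A B} → Split Es W A B → Split Es W B A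
Split-swap sp = record
  { A⊆W = B⊆W ; B⊆W = A⊆W
  ; covers = λ v∈ → x∈p∪q⁺ (swap (x∈p∪q⁻ _ _ (covers v∈)))
  ; disjoint = λ v∈B v∈A → disjoint v∈A v∈B
  ; noEdgeAB = noEdgeBA ; noEdgeBA = noEdgeAB }
  where open Split sp

module Deletion {n} (I : Instance n) where

  NbrOf : Subset n → Fin n → Set
  NbrOf Y v = ∃ λ x → x ∈ Y × Adj (E I) x v

  inN? : ∀ W Y → Decidable (λ v → v ∈ W × NbrOf Y v)
  inN? W Y v = (v ∈? W) ×-dec anyFin? (λ x → (x ∈? Y) ×-dec Adj? (E I) x v)

  Del : Subset n → Subset n → Subset n
  Del W Y = W ─ N I W Y

  Del⁻ : ∀ {W Y v} → v ∈ Del W Y → v ∈ W × ¬ NbrOf Y v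
  Del⁻ {W} {Y} v∈ =
    p─q⊆p W _ v∈ , λ nbr → x∈p─q⇒x∉q W (N I W Y) v∈ (select⁺ (inN? W Y) (p─q⊆p W _ v∈ , nbr))

  Del⁺ : ∀ {W Y v} → v ∈ W → ¬ NbrOf Y v → v ∈ Del W Y
  Del⁺ {W} {Y} v∈W ¬nbr =
    x∈p∧x∉q⇒x∈p─q v∈W (λ v∈N → ¬nbr (proj₂ (select⁻ (inN? W Y) v∈N)))

  Del-mono : ∀ {W W′ Y Y′} → W ⊆ W′ → Y′ ⊆ Y → Del W Y ⊆ Del W′ Y′
  Del-mono W⊆W′ Y′⊆Y v∈ with Del⁻ v∈
  ... | v∈W , ¬nbr = Del⁺ (W⊆W′ v∈W) (λ (x , x∈ , adj) → ¬nbr (x , Y′⊆Y x∈ , adj))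

  Del⊆ : ∀ {W Y} → Del W Y ⊆ W
  Del⊆ {W} {Y} = p─q⊆p W (N I W Y)

  Split-Del : ∀ {W A B} Y → Split (E I) W A B → Split (E I) (Del W Y) (Del A Y) (Del B Y)
  Split-Del {W} {A} {B} Y sp = record
    { A⊆W = Del-mono A⊆W (λ y∈ → y∈)
    ; B⊆W = Del-mono B⊆W (λ y∈ → y∈)
    ; covers = λ v∈ → let v∈W , ¬nbr = Del⁻ v∈ in
        x∈p∪q⁺ (map-⊎ (λ v∈A → Del⁺ v∈A ¬nbr) (λ v∈B → Del⁺ v∈B ¬nbr)
                      (x∈p∪q⁻ A B (covers v∈W)))
    ; disjoint = λ v∈A v∈B → disjoint (Del⊆ v∈A) (Del⊆ v∈B)
    ; noEdgeAB = λ e∈ u∈ v∈ → noEdgeAB e∈ (Del⊆ u∈) (Del⊆ v∈)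
    ; noEdgeBA = λ e∈ u∈ v∈ → noEdgeBA e∈ (Del⊆ u∈) (Del⊆ v∈) }
    where open Split sp

  Del-remove : ∀ {W Y r} → Del W Y - r ⊆ Del (W - r) Y
  Del-remove {W} {Y} {r} v∈ with Del⁻ (p─q⊆p (Del W Y) ⁅ r ⁆ v∈)
  ... | v∈W , ¬nbr = Del⁺ (x∈p∧x≢y⇒x∈p-y v∈W (x∈p-y⇒x≢y (Del W Y) v∈)) ¬nbr

  Away : Fin n → Subset n → Subset n
  Away r U = Del (U - r) ⁅ r ⁆

  Away⁻ : ∀ {r U v} → v ∈ Away r U → v ∈ U × v ≢ r × ¬ Adj (E I) r v
  Away⁻ {r} {U} v∈ with Del⁻ v∈
  ... | v∈U-r , ¬nbr = p─q⊆p U ⁅ r ⁆ v∈U-r , x∈p-y⇒x≢y U v∈U-r , λ adj → ¬nbr (r , x∈⁅x⁆ r , adj)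

  Away⁺ : ∀ {r U v} → v ∈ U → v ≢ r → ¬ Adj (E I) r v → v ∈ Away r U
  Away⁺ {r} v∈U v≢r ¬adj =
    Del⁺ (x∈p∧x≢y⇒x∈p-y v∈U v≢r)
         (λ (x , x∈ , adj) → ¬adj (subst (λ y → Adj (E I) y _) (x∈⁅y⁆⇒x≡y r x∈) adj))

  Away⊆ : ∀ {r U} → Away r U ⊆ U
  Away⊆ {r} {U} v∈ = p─q⊆p U ⁅ r ⁆ (Del⊆ v∈)

  Away-Del : ∀ {W Y r} → Away r (Del W Y) ⊆ Del (Away r W) Y
  Away-Del v∈ with Away⁻ v∈
  ... | v∈Del , v≢r , ¬adj with Del⁻ v∈Del
  ...   | v∈W , ¬nbr = Del⁺ (Away⁺ v∈W v≢r ¬adj) ¬nbr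

  Del-Away : ∀ {W Y r} → Del (Away r W) Y ⊆ Away r (Del W Y)
  Del-Away v∈ with Del⁻ v∈
  ... | v∈Away , ¬nbr with Away⁻ v∈Away
  ...   | v∈W , v≢r , ¬adj = Away⁺ (Del⁺ v∈W ¬nbr) v≢r ¬adj

-- Hyperedges lie in X, so on
-- subsets of R they only matter if one of them is empty; the module assumes
-- they do not matter, and that there are no loops.
module IndependenceNumber {n} (I : Instance n)
         (hyperfree : ∀ {T} → T ⊆ R I → IndepH (H I) T)
         (loopless  : ∀ u v → (u , v) ∈ˡ E I → u ≢ v) where
  open Deletion I

  indep≤α : ∀ {W S} → W ⊆ R I → S ⊆ W → IndepE (E I) S → ∣ S ∣ ≤ α I W
  indep≤α {W} {S} W⊆R S⊆W ind =
    ≤-maximum (∈-map⁺ ∣_∣ (∈-filter⁺ (IndepIn? I W) (allSubsets-complete n S)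
      (S⊆W , (λ x∈ → p─q⊆p (V I) (X I) (W⊆R (S⊆W x∈))) , ind , hyperfree (λ x∈ → W⊆R (S⊆W x∈)))))

  record MaxIndep (W : Subset n) : Set where
    field
      set     : Subset n
      set⊆W   : set ⊆ W
      indep   : IndepE (E I) set
      maximal : α I W ≤ ∣ set ∣

  maxIndep : ∀ W → MaxIndep W
  maxIndep W with maximum-attained (map ∣_∣ (filter (IndepIn? I W) (allSubsets n)))
  ... | inj₁ α≡0 = record
    { set = ∅ ; set⊆W = λ x∈ → ⊥-elim (∉⊥ x∈)
    ; indep = All.tabulate (λ _ both → ∉⊥ (proj₁ both))
    ; maximal = ≤-trans (≤-reflexive α≡0) z≤n }
  ... | inj₂ α∈ with ∈-map⁻ ∣_∣ α∈
  ...   | S , S∈ , α≡∣S∣ with ∈-filter⁻ (IndepIn? I W) {xs = allSubsets n} S∈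
  ...     | _ , S⊆W , _ , ind , _ = record
    { set = S ; set⊆W = S⊆W ; indep = ind ; maximal = ≤-reflexive α≡∣S∣ }

  α-mono : ∀ {W W′} → W ⊆ W′ → W′ ⊆ R I → α I W ≤ α I W′
  α-mono {W} W⊆W′ W′⊆R = ≤-trans maximal (indep≤α W′⊆R (λ x∈ → W⊆W′ (set⊆W x∈)) indep)
    where open MaxIndep (maxIndep W)

  nonempty-of-α : ∀ {W} → 0 < α I W → Nonempty W
  nonempty-of-α {W} pos =
    let x , x∈ = card-nonempty set (<-≤-trans pos maximal) in x , set⊆W x∈
    where open MaxIndep (maxIndep W)

  α-split : ∀ {W A B} → W ⊆ R I → Split (E I) W A B → α I W ≡ α I A + α I B
  α-split {W} {A} {B} W⊆R sp = ≤-antisym subadditive superadditive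
    where
    open Split sp
    A⊆R : A ⊆ R I
    A⊆R x∈ = W⊆R (A⊆W x∈)
    B⊆R : B ⊆ R I
    B⊆R x∈ = W⊆R (B⊆W x∈)
    subadditive : α I W ≤ α I A + α I B
    subadditive = begin
      α I W                           ≤⟨ maximal ⟩
      ∣ set ∣                         ≤⟨ p⊆q⇒∣p∣≤∣q∣ (λ x∈ → x∈p∪q⁺ (pieces x∈)) ⟩
      ∣ set ∩ A ∪ set ∩ B ∣           ≤⟨ ∣p∪q∣≤∣p∣+∣q∣ (set ∩ A) (set ∩ B) ⟩
      ∣ set ∩ A ∣ + ∣ set ∩ B ∣       ≤⟨ +-mono-≤ (part A⊆R) (part B⊆R) ⟩
      α I A + α I B                   ∎
      where
      open ≤-Reasoning
      open MaxIndep (maxIndep W)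
      pieces : ∀ {x} → x ∈ set → x ∈ set ∩ A ⊎ x ∈ set ∩ B
      pieces x∈ with x∈p∪q⁻ A B (covers (set⊆W x∈))
      ... | inj₁ x∈A = inj₁ (x∈p∩q⁺ (x∈ , x∈A))
      ... | inj₂ x∈B = inj₂ (x∈p∩q⁺ (x∈ , x∈B))
      part : ∀ {P} → P ⊆ R I → ∣ set ∩ P ∣ ≤ α I P
      part {P} P⊆R = indep≤α P⊆R (λ x∈ → proj₂ (x∈p∩q⁻ set P x∈))
                       (IndepE-mono (λ x∈ → proj₁ (x∈p∩q⁻ set P x∈)) indep)
    superadditive : α I A + α I B ≤ α I W
    superadditive = begin
      α I A + α I B                   ≤⟨ +-mono-≤ SA.maximal SB.maximal ⟩
      ∣ SA.set ∣ + ∣ SB.set ∣         ≤⟨ disjoint⇒∣p∣+∣q∣≤∣p∪q∣ SA.set SB.set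
                                           (λ x∈A x∈B → disjoint (SA.set⊆W x∈A) (SB.set⊆W x∈B)) ⟩
      ∣ SA.set ∪ SB.set ∣             ≤⟨ indep≤α W⊆R (∪-⊆ (λ x∈ → A⊆W (SA.set⊆W x∈))
                                                            (λ x∈ → B⊆W (SB.set⊆W x∈)))
                                           (IndepE-∪ SA.indep SB.indep
                                             (λ e∈ u∈ v∈ → noEdgeAB e∈ (SA.set⊆W u∈) (SB.set⊆W v∈))
                                             (λ e∈ u∈ v∈ → noEdgeBA e∈ (SB.set⊆W u∈) (SA.set⊆W v∈))) ⟩
      α I W                           ∎
      where
      open ≤-Reasoning
      module SA = MaxIndep (maxIndep A)
      module SB = MaxIndep (maxIndep B)

  -- Y lowers the independence number of W, i.e. conf_W(Y) > 0.
  Drops : Subset n → Subset n → Set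
  Drops W Y = α I (Del W Y) < α I W

  drops-split : ∀ {W A B Y} → W ⊆ R I → Split (E I) W A B → Drops W Y → Drops A Y ⊎ Drops B Y
  drops-split {W} {A} {B} {Y} W⊆R sp dropW
    with α I (Del A Y) <? α I A | α I (Del B Y) <? α I B
  ... | yes dropA | _         = inj₁ dropA
  ... | no _      | yes dropB = inj₂ dropB
  ... | no ¬dropA | no ¬dropB = ⊥-elim (<⇒≱ dropW (begin
    α I W                          ≡⟨ α-split W⊆R sp ⟩
    α I A + α I B                  ≤⟨ +-mono-≤ (≮⇒≥ ¬dropA) (≮⇒≥ ¬dropB) ⟩
    α I (Del A Y) + α I (Del B Y)  ≡⟨ α-split (λ v∈ → W⊆R (Del⊆ v∈)) (Split-Del Y sp) ⟨
    α I (Del W Y)                  ∎))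
    where open ≤-Reasoning

  drops-lift : ∀ {W A B Y} → W ⊆ R I → Split (E I) W A B → Drops A Y → Drops W Y
  drops-lift {W} {A} {B} {Y} W⊆R sp dropA = begin-strict
    α I (Del W Y)                  ≡⟨ α-split (λ v∈ → W⊆R (Del⊆ v∈)) (Split-Del Y sp) ⟩
    α I (Del A Y) + α I (Del B Y)  <⟨ +-mono-<-≤ dropA
                                        (α-mono Del⊆ (λ v∈ → W⊆R (Split.B⊆W sp v∈))) ⟩
    α I A + α I B                  ≡⟨ α-split W⊆R sp ⟨
    α I W                          ∎
    where open ≤-Reasoning

  α-extend : ∀ {U Z r} → U ⊆ R I → r ∈ U → Z ⊆ Away r U → suc (α I Z) ≤ α I U
  α-extend {U} {Z} {r} U⊆R r∈U Z⊆ = begin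
    suc (α I Z)          ≤⟨ s≤s maximal ⟩
    suc ∣ set ∣          ≡⟨ cong (_+ ∣ set ∣) (∣⁅x⁆∣≡1 r) ⟨
    ∣ ⁅ r ⁆ ∣ + ∣ set ∣  ≤⟨ disjoint⇒∣p∣+∣q∣≤∣p∪q∣ ⁅ r ⁆ set
                              (λ x∈r x∈ → proj₁ (proj₂ (away x∈)) (x∈⁅y⁆⇒x≡y r x∈r)) ⟩
    ∣ ⁅ r ⁆ ∪ set ∣      ≤⟨ indep≤α U⊆R (∪-⊆ r-in (λ x∈ → proj₁ (away x∈)))
                              (IndepE-∪ r-indep indep r→set set→r) ⟩
    α I U                ∎
    where
    open ≤-Reasoning
    open MaxIndep (maxIndep Z)
    away : ∀ {v} → v ∈ set → v ∈ U × v ≢ r × ¬ Adj (E I) r v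
    away v∈ = Away⁻ (Z⊆ (set⊆W v∈))
    r-in : ⁅ r ⁆ ⊆ U
    r-in x∈ = subst (_∈ U) (sym (x∈⁅y⁆⇒x≡y r x∈)) r∈U
    r-indep : IndepE (E I) ⁅ r ⁆
    r-indep = All.tabulate λ {e} e∈ (u∈ , v∈) →
      loopless _ _ e∈ (trans (x∈⁅y⁆⇒x≡y r u∈) (sym (x∈⁅y⁆⇒x≡y r v∈)))
    r→set : NoEdge (E I) ⁅ r ⁆ set
    r→set {u} {v} e∈ u∈ v∈ rewrite x∈⁅y⁆⇒x≡y r u∈ = proj₂ (proj₂ (away v∈)) (edge⇒Adj (inj₁ e∈))
    set→r : NoEdge (E I) set ⁅ r ⁆
    set→r {u} {v} e∈ u∈ v∈ rewrite x∈⁅y⁆⇒x≡y r v∈ = proj₂ (proj₂ (away u∈)) (edge⇒Adj (inj₂ e∈))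

  -- The branching recurrence α(U) ≤ max(α(U − r), 1 + α(U − N[r])): a
  -- maximum independent set either avoids r or contains r and avoids N(r).
  α-branch : ∀ {U} r → U ⊆ R I → α I U ≤ α I (U - r) ⊔ suc (α I (Away r U))
  α-branch {U} r U⊆R = ≤-trans maximal (branch (r ∈? set))
    where
    open MaxIndep (maxIndep U)
    branch : Dec (r ∈ set) → ∣ set ∣ ≤ α I (U - r) ⊔ suc (α I (Away r U))
    branch (no r∉) = ≤-trans
      (indep≤α (λ v∈ → U⊆R (p─q⊆p U ⁅ r ⁆ v∈))
               (λ v∈ → x∈p∧x≢y⇒x∈p-y (set⊆W v∈) (λ { refl → r∉ v∈ })) indep)
      (m≤m⊔n _ _)
    branch (yes r∈) = ≤-trans (∣p∣≤1+∣p-x∣ set r) (≤-trans (s≤s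
      (indep≤α (λ v∈ → U⊆R (proj₁ (Away⁻ v∈)))
               (λ v∈ → Away⁺ (set⊆W (p─q⊆p set ⁅ r ⁆ v∈)) (x∈p-y⇒x≢y set v∈)
                              (Indep-adj indep r∈ (p─q⊆p set ⁅ r ⁆ v∈)))
               (IndepE-mono (p─q⊆p set ⁅ r ⁆) indep)))
      (m≤n⊔m _ _))

module Forest {n} {Es : List (Fin n × Fin n)} {W : Subset n} {c : ℕ}
              (F : ForestOfHeight≤ Es W c) where
  open ForestOfHeight≤ F

  anc-trans : ∀ {a u v} → Anc par a u → Anc par u v → Anc par a v
  anc-trans a≼u self       = a≼u
  anc-trans a≼u (up e u≼w) = up e (anc-trans a≼u u≼w)

  anc-chain : ∀ {a b u} → Anc par a u → Anc par b u → Anc par a b ⊎ Anc par b a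
  anc-chain self        b≼u          = inj₂ b≼u
  anc-chain (up e a≼w)  self         = inj₁ (up e a≼w)
  anc-chain (up e a≼w)  (up e′ b≼w′) with trans (sym e) e′
  ... | refl = anc-chain a≼w b≼w′

  anc-depth : ∀ {u v} → Anc par u v → v ∈ W → u ∈ W × (u ≡ v ⊎ depth u < depth v)
  anc-depth self v∈ = v∈ , inj₁ refl
  anc-depth {v = v} (up {w = w} e u≼w) v∈ with anc-depth u≼w (par-in v w v∈ e)
  ... | u∈ , inj₁ refl = u∈ , inj₂ (≤-reflexive (sym (par-dep v w v∈ e)))
  ... | u∈ , inj₂ lt   = u∈ , inj₂ (<-trans lt (≤-reflexive (sym (par-dep v w v∈ e))))

  anc-parent : ∀ {r v w} → par v ≡ just w → r ≢ v → Anc par r v → Anc par r w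
  anc-parent _ r≢v self = ⊥-elim (r≢v refl)
  anc-parent e r≢v (up e′ r≼w′) with trans (sym e) e′
  ... | refl = r≼w′

  root-anc : ∀ {r v} → par v ≡ nothing → Anc par r v → r ≡ v
  root-anc _ self = refl
  root-anc e (up e′ _) with trans (sym e) e′
  ... | ()

  anc? : ∀ r v → v ∈ W → Dec (Anc par r v)
  anc? r v v∈ = go (depth v) v v∈ ≤-refl
    where
    go : ∀ k v → v ∈ W → depth v ≤ k → Dec (Anc par r v)
    go zero    v v∈ d≤0 = ⊥-elim (n≮0 (<-≤-trans (depth≥1 v v∈) d≤0))
    go (suc k) v v∈ d≤k with r ≟ᶠ v | par v in e
    ... | yes refl | _      = yes self
    ... | no r≢v   | nothing = no (λ r≼v → r≢v (root-anc e r≼v))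
    ... | no r≢v   | just w =
      map′ (up e) (anc-parent e r≢v)
           (go k w (par-in v w v∈ e) (≤-pred (≤-trans (≤-reflexive (sym (par-dep v w v∈ e))) d≤k)))

  Window : Subset n → ℕ → Set
  Window Z d = ∃ λ b → ∀ {v} → v ∈ Z → b < depth v × depth v ≤ b + d

  Window-mono : ∀ {Z Z′ d} → Z′ ⊆ Z → Window Z d → Window Z′ d
  Window-mono Z′⊆Z (b , within) = b , λ v∈ → within (Z′⊆Z v∈)

  Window-empty : ∀ {Z v} → Window Z 0 → v ∉ Z
  Window-empty (b , within) v∈ with within v∈
  ... | b<d , d≤b = <-irrefl refl (<-≤-trans b<d (≤-trans d≤b (≤-reflexive (+-identityʳ b))))

  Window-below : ∀ {Z A r d} → Z ⊆ W → A ⊆ Z → r ∈ Z → (∀ {v} → v ∈ A → Anc par r v) →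
                 Window Z (suc d) → Window (A - r) d
  Window-below {Z} {A} {r} {d} Z⊆W A⊆Z r∈Z below (b , within) = depth r , bounds
    where
    bounds : ∀ {v} → v ∈ A - r → depth r < depth v × depth v ≤ depth r + d
    bounds {v} v∈ with anc-depth (below (p─q⊆p A ⁅ r ⁆ v∈)) (Z⊆W (A⊆Z (p─q⊆p A ⁅ r ⁆ v∈)))
    ... | _ , inj₁ r≡v = ⊥-elim (x∈p-y⇒x≢y A v∈ (sym r≡v))
    ... | _ , inj₂ r<v = r<v , (begin
      depth v        ≤⟨ proj₂ (within (A⊆Z (p─q⊆p A ⁅ r ⁆ v∈))) ⟩
      b + suc d      ≡⟨ +-suc b d ⟩
      suc b + d      ≤⟨ +-monoˡ-≤ d (proj₁ (within r∈Z)) ⟩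
      depth r + d    ∎)
      where open ≤-Reasoning

  -- Splitting U ⊆ W at a shallowest vertex r: the vertices below r and the
  -- rest.  They are not adjacent, as every edge joins a vertex to one of its
  -- ancestors, and an ancestor of a vertex below r is below r or above r.
  module Subtree {U : Subset n} (U⊆W : U ⊆ W) {r : Fin n} (r∈U : r ∈ U)
                 (shallowest : ∀ {u} → u ∈ U → depth r ≤ depth u) where

    below? : Decidable (λ v → v ∈ U × Anc par r v)
    below? v with v ∈? U
    ... | yes v∈ = map′ (v∈ ,_) proj₂ (anc? r v (U⊆W v∈))
    ... | no v∉  = no (λ below → v∉ (proj₁ below))

    Below : Subset n
    Below = select below?

    Rest : Subset n
    Rest = U ─ Below

    Below⁻ : ∀ {v} → v ∈ Below → v ∈ U × Anc par r v
    Below⁻ = select⁻ below?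

    r∈Below : r ∈ Below
    r∈Below = select⁺ below? (r∈U , self)

    r∉Rest : r ∉ Rest
    r∉Rest r∈ = x∈p─q⇒x∉q U Below r∈ r∈Below

    incomparable : ∀ {a b} → a ∈ Below → b ∈ Rest → Anc par a b ⊎ Anc par b a → ⊥
    incomparable {a} {b} a∈ b∈ a≼b⊎b≼a = x∈p─q⇒x∉q U Below b∈ (select⁺ below? (b∈U , r≼b a≼b⊎b≼a))
      where
      b∈U : b ∈ U
      b∈U = p─q⊆p U Below b∈
      r≼a : Anc par r a
      r≼a = proj₂ (Below⁻ a∈)
      r≼b : Anc par a b ⊎ Anc par b a → Anc par r b
      r≼b (inj₁ a≼b) = anc-trans r≼a a≼b
      r≼b (inj₂ b≼a) with anc-chain r≼a b≼a
      ... | inj₁ r≼b = r≼b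
      ... | inj₂ b≼r with anc-depth b≼r (U⊆W r∈U)
      ...   | _ , inj₁ refl = self
      ...   | _ , inj₂ b<r  = ⊥-elim (<⇒≱ b<r (shallowest b∈U))

    split : Split Es U Below Rest
    split = record
      { A⊆W = λ v∈ → proj₁ (Below⁻ v∈)
      ; B⊆W = p─q⊆p U Below
      ; covers = covers
      ; disjoint = λ v∈B v∈R → x∈p─q⇒x∉q U Below v∈R v∈B
      ; noEdgeAB = λ {u} {v} e∈ u∈ v∈ →
          incomparable u∈ v∈ (closure u v e∈ (in-W u∈) (U⊆W (p─q⊆p U Below v∈)))
      ; noEdgeBA = λ {u} {v} e∈ u∈ v∈ →
          incomparable v∈ u∈ (swap (closure u v e∈ (U⊆W (p─q⊆p U Below u∈)) (in-W v∈))) }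
      where
      in-W : ∀ {v} → v ∈ Below → v ∈ W
      in-W v∈ = U⊆W (proj₁ (Below⁻ v∈))
      covers : U ⊆ Below ∪ Rest
      covers {v} v∈ with v ∈? Below
      ... | yes v∈B = x∈p∪q⁺ (inj₁ v∈B)
      ... | no v∉B  = x∈p∪q⁺ (inj₂ (x∈p∧x∉q⇒x∈p─q v∈ v∉B))

module SmallWitness {n} (I : Instance n) {c : ℕ}
         (hyperfree : ∀ {T} → T ⊆ R I → IndepH (H I) T)
         (loopless  : ∀ u v → (u , v) ∈ˡ E I → u ≢ v)
         (forest    : td≤ (E I) (R I) c) where
  open Deletion I
  open IndependenceNumber I hyperfree loopless
  open Forest forest
  open ForestOfHeight≤ forest using (depth)

  Witness : Subset n → Subset n → ℕ → Set
  Witness Z Y d = ∃ λ Y′ → Y′ ⊆ Y × ∣ Y′ ∣ ≤ 2 ^ d × Drops Z Y′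

  SmallWitnesses : ℕ → Set
  SmallWitnesses d = ∀ {Z Y} → Z ⊆ R I → Window Z d → Drops Z Y → Witness Z Y d

  ∣∅∣≤2^d : ∀ d → ∣ ∅ {n} ∣ ≤ 2 ^ d
  ∣∅∣≤2^d d = ≤-trans (≤-reflexive (∣⊥∣≡0 n)) z≤n

  -- Either
  -- Y′ = ∅ suffices, or s + α(Z) = t and Y makes Z drop.
  bounded-witness : ∀ {d} → SmallWitnesses d → ∀ {Z Y} s t → Z ⊆ R I → Window Z d →
                    s + α I Z ≤ t → s + α I (Del Z Y) < t →
                    ∃ λ Y′ → Y′ ⊆ Y × ∣ Y′ ∣ ≤ 2 ^ d × s + α I (Del Z Y′) < t
  bounded-witness {d} witnesses {Z} {Y} s t Z⊆R window sZ≤t below with s + α I Z <? t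
  ... | yes sZ<t = ∅ , (λ x∈ → ⊥-elim (∉⊥ x∈)) , ∣∅∣≤2^d d ,
                   ≤-<-trans (+-monoʳ-≤ s (α-mono Del⊆ Z⊆R)) sZ<t
  ... | no sZ≮t with witnesses Z⊆R window
                       (+-cancelˡ-< s (α I (Del Z Y)) (α I Z) (<-≤-trans below (≮⇒≥ sZ≮t)))
  ...   | Y′ , Y′⊆Y , small , drop = Y′ , Y′⊆Y , small , <-≤-trans (+-monoʳ-< s drop) sZ≤t

  module Root {A : Subset n} {r : Fin n} (A⊆R : A ⊆ R I) (r∈A : r ∈ A) where

    inR : ∀ {Z} → Z ⊆ A → Z ⊆ R I
    inR Z⊆A v∈ = A⊆R (Z⊆A v∈)

    A-r⊆A : A - r ⊆ A
    A-r⊆A = p─q⊆p A ⁅ r ⁆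

    -- If r has a neighbour x ∈ Y, deleting N({x} ∪ Y₁) also deletes r, so a
    -- witness Y₁ for A − r gives the witness {x} ∪ Y₁ for A.
    adjacent-case : ∀ {d Y Y₁ x} → Y₁ ⊆ Y → ∣ Y₁ ∣ ≤ 2 ^ d → α I (Del (A - r) Y₁) < α I A →
                    x ∈ Y → Adj (E I) x r → Witness A Y (suc d)
    adjacent-case {d} {Y} {Y₁} {x} Y₁⊆Y small₁ drop₁ x∈Y x~r =
      ⁅ x ⁆ ∪ Y₁ , ∪-⊆ x-in Y₁⊆Y , size ,
      ≤-<-trans (α-mono Del⊆Del-r (inR (λ v∈ → A-r⊆A (Del⊆ v∈)))) drop₁
      where
      x-in : ⁅ x ⁆ ⊆ Y
      x-in y∈ = subst (_∈ Y) (sym (x∈⁅y⁆⇒x≡y x y∈)) x∈Y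
      size : ∣ ⁅ x ⁆ ∪ Y₁ ∣ ≤ 2 ^ suc d
      size = ≤-trans (∣p∪q∣≤∣p∣+∣q∣ ⁅ x ⁆ Y₁)
                     (double d (≤-trans (≤-reflexive (∣⁅x⁆∣≡1 x)) (m^n>0 2 d)) small₁)
      Del⊆Del-r : Del A (⁅ x ⁆ ∪ Y₁) ⊆ Del (A - r) Y₁
      Del⊆Del-r {v} v∈ with Del⁻ v∈
      ... | v∈A , ¬nbr =
        Del⁺ (x∈p∧x≢y⇒x∈p-y v∈A (λ { refl → ¬nbr (x , p⊆p∪q Y₁ (x∈⁅x⁆ x) , x~r) }))
             (λ (z , z∈ , adj) → ¬nbr (z , q⊆p∪q ⁅ x ⁆ Y₁ z∈ , adj))

    -- Otherwise a witness Y₁ for A − r and a witness Y₂ for A − N[r] are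
    -- united; by the branching recurrence Y₁ ∪ Y₂ makes A drop.
    branch-case : ∀ {d Y Y₁ Y₂} →
                  Y₁ ⊆ Y → ∣ Y₁ ∣ ≤ 2 ^ d → α I (Del (A - r) Y₁) < α I A →
                  Y₂ ⊆ Y → ∣ Y₂ ∣ ≤ 2 ^ d → suc (α I (Del (Away r A) Y₂)) < α I A →
                  Witness A Y (suc d)
    branch-case {d} {Y} {Y₁} {Y₂} Y₁⊆Y small₁ drop₁ Y₂⊆Y small₂ drop₂ =
      Y₁ ∪ Y₂ , ∪-⊆ Y₁⊆Y Y₂⊆Y , ≤-trans (∣p∪q∣≤∣p∣+∣q∣ Y₁ Y₂) (double d small₁ small₂) ,
      (begin-strict
        α I (Del A (Y₁ ∪ Y₂))                                              ≤⟨ α-branch r (inR Del⊆) ⟩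
        α I (Del A (Y₁ ∪ Y₂) - r) ⊔ suc (α I (Away r (Del A (Y₁ ∪ Y₂))))   <⟨ ⊔-lub avoid-r take-r ⟩
        α I A                                                              ∎)
      where
      open ≤-Reasoning
      avoid-r : suc (α I (Del A (Y₁ ∪ Y₂) - r)) ≤ α I A
      avoid-r = ≤-<-trans (α-mono (λ v∈ → Del-mono (λ w∈ → w∈) (p⊆p∪q Y₂) (Del-remove v∈))
                                  (inR (λ v∈ → A-r⊆A (Del⊆ v∈))))
                          drop₁
      take-r : suc (suc (α I (Away r (Del A (Y₁ ∪ Y₂))))) ≤ α I A
      take-r = ≤-<-trans (s≤s (α-mono (λ v∈ → Del-mono (λ w∈ → w∈) (q⊆p∪q Y₁ Y₂) (Away-Del v∈))
                                      (inR (λ v∈ → Away⊆ (Del⊆ v∈)))))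
                         drop₂

    -- Both witnesses come from the thresholded lemma at width d; the second
    -- uses 1 + α(Z − N[r]) ≤ α(Z) for Z = A and Z = A ∖ N(Y) ∋ r.
    root-witness : ∀ {d Y} → SmallWitnesses d → Window (A - r) d → Drops A Y → Witness A Y (suc d)
    root-witness {d} {Y} witnesses window dropA
      with bounded-witness witnesses 0 (α I A) (inR A-r⊆A) window (α-mono A-r⊆A A⊆R)
             (≤-<-trans (α-mono (Del-mono A-r⊆A (λ y∈ → y∈)) (inR Del⊆)) dropA)
    ... | Y₁ , Y₁⊆Y , small₁ , drop₁ with anyFin? (λ x → (x ∈? Y) ×-dec Adj? (E I) x r)
    ...   | yes (x , x∈Y , x~r) = adjacent-case {d} Y₁⊆Y small₁ drop₁ x∈Y x~r
    ...   | no r≁Y with bounded-witness witnesses 1 (α I A) (inR Away⊆) (Window-mono Del⊆ window)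
                          (α-extend A⊆R r∈A (λ v∈ → v∈))
                          (≤-<-trans (α-extend (inR Del⊆) (Del⁺ r∈A r≁Y) Del-Away) dropA)
    ...     | Y₂ , Y₂⊆Y , small₂ , drop₂ = branch-case {d} Y₁⊆Y small₁ drop₁ Y₂⊆Y small₂ drop₂

  -- Induction on the width, and for fixed width on |Z|: split Z at a
  -- shallowest vertex r; a drop of Z is a drop of the subtree below r (the
  -- root case) or of the strictly smaller rest.
  small-witness : ∀ d → SmallWitnesses d
  small-witness zero Z⊆R window drop =
    ⊥-elim (Window-empty window (proj₂ (nonempty-of-α (≤-trans (s≤s z≤n) drop))))
  small-witness (suc d) {Z} {Y} Z⊆R window drop = go Z (<-wellFounded ∣ Z ∣) Z⊆R window drop
    where
    go : ∀ Z → Acc _<_ ∣ Z ∣ → Z ⊆ R I → Window Z (suc d) → Drops Z Y → Witness Z Y (suc d)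
    go Z (acc smaller) Z⊆R window drop =
      let _ , r∈Z , shallowest = argmin depth Z (nonempty-of-α (≤-trans (s≤s z≤n) drop))
      in split-at r∈Z shallowest
      where
      split-at : ∀ {r} → r ∈ Z → (∀ {u} → u ∈ Z → depth r ≤ depth u) → Witness Z Y (suc d)
      split-at {r} r∈Z shallowest = [ via-below , via-rest ] (drops-split Z⊆R split drop)
        where
        open Subtree Z⊆R r∈Z shallowest
        Below⊆Z : Below ⊆ Z
        Below⊆Z v∈ = proj₁ (Below⁻ v∈)
        via-below : Drops Below Y → Witness Z Y (suc d)
        via-below dropB with Root.root-witness (λ v∈ → Z⊆R (Below⊆Z v∈)) r∈Below (small-witness d)
                               (Window-below Z⊆R Below⊆Z r∈Z (λ v∈ → proj₂ (Below⁻ v∈)) window) dropB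
        ... | Y′ , Y′⊆Y , small , drop′ = Y′ , Y′⊆Y , small , drops-lift Z⊆R split drop′
        via-rest : Drops Rest Y → Witness Z Y (suc d)
        via-rest dropR with go Rest (smaller (p⊂q⇒∣p∣<∣q∣ (Rest⊆Z , r , r∈Z , r∉Rest)))
                               (λ v∈ → Z⊆R (Rest⊆Z v∈)) (Window-mono Rest⊆Z window) dropR
          where
          Rest⊆Z : Rest ⊆ Z
          Rest⊆Z = p─q⊆p Z Below
        ... | Y′ , Y′⊆Y , small , drop′ = Y′ , Y′⊆Y , small , drops-lift Z⊆R (Split-swap split) drop′

≤+⇒-≤ : ∀ (i j l : ℤ) → i ℤ.≤ j ℤ.+ l → i ℤ.- l ℤ.≤ j
≤+⇒-≤ i j l i≤j+l = begin
  i ℤ.- l              ≤⟨ ℤₚ.+-monoˡ-≤ (ℤ.- l) i≤j+l ⟩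
  j ℤ.+ l ℤ.- l        ≡⟨ ℤₚ.+-assoc j l (ℤ.- l) ⟩
  j ℤ.+ (l ℤ.- l)      ≡⟨ cong (λ z → j ℤ.+ z) (ℤₚ.+-inverseʳ l) ⟩
  j ℤ.+ 0ℤ             ≡⟨ ℤₚ.+-identityʳ j ⟩
  j                    ∎
  where open ℤₚ.≤-Reasoning

-≤⇒≤+ : ∀ (i j l : ℤ) → i ℤ.- l ℤ.≤ j → i ℤ.≤ j ℤ.+ l
-≤⇒≤+ i j l i-l≤j = begin
  i                    ≡⟨ ℤₚ.+-identityʳ i ⟨
  i ℤ.+ 0ℤ             ≡⟨ cong (λ z → i ℤ.+ z) (ℤₚ.+-inverseˡ l) ⟨
  i ℤ.+ (ℤ.- l ℤ.+ l)  ≡⟨ ℤₚ.+-assoc i (ℤ.- l) l ⟨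
  i ℤ.- l ℤ.+ l        ≤⟨ ℤₚ.+-monoˡ-≤ l i-l≤j ⟩
  j ℤ.+ l              ∎
  where open ℤₚ.≤-Reasoning

module Reduction {c n : ℕ} {I : Instance n} (inst : IsInstance c I) {R′ : Subset n}
                 (component : IsComponent (E I) (R I) R′) where
  open IsInstance inst
  open Deletion I

  R′⊆R : R′ ⊆ R I
  R′⊆R = proj₁ component

  X∩R=∅ : ∀ {x} → x ∈ X I → x ∉ R I
  X∩R=∅ x∈X x∈R = x∈p─q⇒x∉q (V I) (X I) x∈R x∈X

  -- Hyperedges lie in X, so one H-independent set makes every subset of R
  -- H-independent.
  hyperfree : ∀ {S} → IndepH (H I) S → ∀ {T} → T ⊆ R I → IndepH (H I) T
  hyperfree indH T⊆R = All.tabulate λ {h} h∈ h⊆T →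
    All.lookup indH h∈ (λ x∈h → ⊥-elim (X∩R=∅ (hyp-X h h∈ x∈h) (T⊆R (h⊆T x∈h))))

  sound : Yes I → Yes (delete I R′)
  sound (S , (S⊆V , indE , indH) , k≤S) =
    S ─ R′ , (S─R′⊆V─R′ , indE′ , IndepH-mono (p─q⊆p S R′) indH) , ≤+⇒-≤ _ _ _ k≤S─R′+α
    where
    open IndependenceNumber I (hyperfree indH) edge-2
    S─R′⊆V─R′ : S ─ R′ ⊆ V I ─ R′
    S─R′⊆V─R′ v∈ = x∈p∧x∉q⇒x∈p─q (S⊆V (p─q⊆p S R′ v∈)) (x∈p─q⇒x∉q S R′ v∈)
    indE′ : IndepE (E (delete I R′)) (S ─ R′)
    indE′ = Allₚ.filter⁺ (λ e → ¬? (touches R′ e)) (IndepE-mono (p─q⊆p S R′) indE)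
    split-S : S ⊆ (S ─ R′) ∪ (S ∩ R′)
    split-S {v} v∈ with v ∈? R′
    ... | yes v∈R′ = x∈p∪q⁺ (inj₂ (x∈p∩q⁺ (v∈ , v∈R′)))
    ... | no v∉R′  = x∈p∪q⁺ (inj₁ (x∈p∧x∉q⇒x∈p─q v∈ v∉R′))
    size : ∣ S ∣ ≤ ∣ S ─ R′ ∣ + α I R′
    size = begin
      ∣ S ∣                      ≤⟨ p⊆q⇒∣p∣≤∣q∣ split-S ⟩
      ∣ (S ─ R′) ∪ (S ∩ R′) ∣    ≤⟨ ∣p∪q∣≤∣p∣+∣q∣ (S ─ R′) (S ∩ R′) ⟩
      ∣ S ─ R′ ∣ + ∣ S ∩ R′ ∣    ≤⟨ +-monoʳ-≤ ∣ S ─ R′ ∣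
                                       (indep≤α R′⊆R (p∩q⊆q S R′) (IndepE-mono (p∩q⊆p S R′) indE)) ⟩
      ∣ S ─ R′ ∣ + α I R′        ∎
      where open ≤-Reasoning
    k≤S─R′+α : k I ℤ.≤ ℤ.+ ∣ S ─ R′ ∣ ℤ.+ ℤ.+ α I R′
    k≤S─R′+α = subst (k I ℤ.≤_) (ℤₚ.pos-+ ∣ S ─ R′ ∣ (α I R′)) (ℤₚ.≤-trans k≤S (ℤ.+≤+ size))

  -- If no chunk has a conflict, neither has any Y ⊆ X spanning no
  -- hyperedge: a conflict would have a witness of at most 2^c vertices
  -- (R′ has window width c), which is nonempty and hence a chunk.
  no-conflict-extends : ((X′ : Subset n) → IsChunk c I X′ → conf I R′ X′ ≡ 0ℤ) →
                        ∀ {Y} → Y ⊆ X I → IndepH (H I) Y → α I R′ ≤ α I (Del R′ Y)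
  no-conflict-extends no-conflict {Y} Y⊆X indH = ≮⇒≥ no-drop
    where
    open IndependenceNumber I (hyperfree indH) edge-2
    open SmallWitness I (hyperfree indH) edge-2 td-R
    open ForestOfHeight≤ td-R using (depth≥1; depth≤c)
    no-drop : ¬ Drops R′ Y
    no-drop drop with small-witness c R′⊆R (0 , λ {v} v∈ → depth≥1 v (R′⊆R v∈) , depth≤c v (R′⊆R v∈)) drop
    ... | Y′ , Y′⊆Y , small , drop′ with nonempty? Y′
    ...   | no empty = <⇒≱ drop′ (α-mono (λ v∈ → Del⁺ v∈ λ (x , x∈ , _) → empty (x , x∈))
                                         (λ v∈ → R′⊆R (Del⊆ v∈)))
    ...   | yes (x , x∈) = <-irrefl (sym α-unchanged) drop′
      where
      chunk : IsChunk c I Y′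
      chunk = (λ v∈ → Y⊆X (Y′⊆Y v∈)) , card-pos Y′ x∈ , small , IndepH-mono Y′⊆Y indH
      α-unchanged : α I R′ ≡ α I (Del R′ Y′)
      α-unchanged = ℤₚ.+-injective (ℤₚ.i-j≡0⇒i≡j _ _ (no-conflict Y′ chunk))

  -- An edge between
  -- u ∈ S′ and v ∈ T is impossible: if u ∈ X then v ∈ N(S′ ∩ X); otherwise
  -- u ∈ R, so u would lie in the component R′ of v.  Hyperedges lie in X,
  -- which T avoids.
  extend-indep : ∀ {S′ T} → Indep (delete I R′) S′ → T ⊆ Del R′ (S′ ∩ X I) → IndepE (E I) T →
                 Indep I (S′ ∪ T)
  extend-indep {S′} {T} (S′⊆V─R′ , indE′ , indH) T⊆Del indT =
    ∪-⊆ S′⊆V (λ v∈ → p─q⊆p (V I) (X I) (R′⊆R (T⊆R′ v∈))) ,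
    IndepE-∪ indE-S′ indT (λ e∈ u∈ v∈ → no-edge u∈ v∈ (inj₁ e∈))
                          (λ e∈ u∈ v∈ → no-edge v∈ u∈ (inj₂ e∈)) ,
    indH∪
    where
    S′⊆V : S′ ⊆ V I
    S′⊆V v∈ = p─q⊆p (V I) R′ (S′⊆V─R′ v∈)
    S′∩R′=∅ : ∀ {v} → v ∈ S′ → v ∉ R′
    S′∩R′=∅ v∈ = x∈p─q⇒x∉q (V I) R′ (S′⊆V─R′ v∈)
    T⊆R′ : T ⊆ R′
    T⊆R′ v∈ = Del⊆ (T⊆Del v∈)
    indE-S′ : IndepE (E I) S′
    indE-S′ = All.tabulate λ e∈ both@(u∈ , v∈) →
      All.lookup indE′ (∈-filter⁺ (λ e → ¬? (touches R′ e)) e∈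
        λ { (inj₁ u∈R′) → S′∩R′=∅ u∈ u∈R′ ; (inj₂ v∈R′) → S′∩R′=∅ v∈ v∈R′ }) both
    no-edge : ∀ {u v} → u ∈ S′ → v ∈ T → (u , v) ∈ˡ E I ⊎ (v , u) ∈ˡ E I → ⊥
    no-edge {u} {v} u∈ v∈ e with u ∈? X I
    ... | yes u∈X = proj₂ (Del⁻ (T⊆Del v∈)) (u , x∈p∩q⁺ (u∈ , u∈X) , edge⇒Adj e)
    ... | no u∉X  = S′∩R′=∅ u∈ (proj₂ (proj₂ (proj₂ component)) v u (T⊆R′ v∈)
                      (step here (R′⊆R (T⊆R′ v∈)) (x∈p∧x∉q⇒x∈p─q (S′⊆V u∈) u∉X) (swap e)))
    indH∪ : IndepH (H I) (S′ ∪ T)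
    indH∪ = All.tabulate λ {h} h∈ h⊆S′∪T → All.lookup indH h∈ λ x∈h →
      [ (λ x∈S′ → x∈S′) , (λ x∈T → ⊥-elim (X∩R=∅ (hyp-X h h∈ x∈h) (R′⊆R (T⊆R′ x∈T)))) ]
        (x∈p∪q⁻ S′ T (h⊆S′∪T x∈h))

  -- Conversely, if no chunk has a conflict, an independent set S′ of the
  -- reduced instance extends by a maximum independent set T of R′ ∖ N(Y),
  -- Y = S′ ∩ X, and α(R′ ∖ N(Y)) = α(R′) restores the budget.
  complete : ((X′ : Subset n) → IsChunk c I X′ → conf I R′ X′ ≡ 0ℤ) →
             Yes (delete I R′) → Yes I
  complete no-conflict (S′ , indS′@(S′⊆V─R′ , _ , indH) , k-α≤S′) =
    S′ ∪ T , extend-indep indS′ T⊆Del indT , budget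
    where
    open IndependenceNumber I (hyperfree indH) edge-2
    Y : Subset n
    Y = S′ ∩ X I
    open MaxIndep (maxIndep (Del R′ Y)) renaming (set to T; set⊆W to T⊆Del; indep to indT)
    size : ∣ S′ ∣ + α I R′ ≤ ∣ S′ ∪ T ∣
    size = begin
      ∣ S′ ∣ + α I R′           ≤⟨ +-monoʳ-≤ ∣ S′ ∣ (no-conflict-extends no-conflict
                                      (p∩q⊆q S′ (X I)) (IndepH-mono (p∩q⊆p S′ (X I)) indH)) ⟩
      ∣ S′ ∣ + α I (Del R′ Y)   ≤⟨ +-monoʳ-≤ ∣ S′ ∣ maximal ⟩
      ∣ S′ ∣ + ∣ T ∣            ≤⟨ disjoint⇒∣p∣+∣q∣≤∣p∪q∣ S′ T (λ v∈S′ v∈T →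
                                     x∈p─q⇒x∉q (V I) R′ (S′⊆V─R′ v∈S′) (Del⊆ (T⊆Del v∈T))) ⟩
      ∣ S′ ∪ T ∣                ∎
      where open ≤-Reasoning
    budget : k I ℤ.≤ ℤ.+ ∣ S′ ∪ T ∣
    budget = ℤₚ.≤-trans (-≤⇒≤+ _ _ _ k-α≤S′)
               (ℤₚ.≤-trans (ℤₚ.≤-reflexive (sym (ℤₚ.pos-+ ∣ S′ ∣ (α I R′)))) (ℤ.+≤+ size))

lemma5 : (c : ℕ) → 1 ≤ c → (n : ℕ) → (I : Instance n) → IsInstance c I →
         (R′ : Subset n) → IsComponent (E I) (R I) R′ →
         ((X′ : Subset n) → IsChunk c I X′ → conf I R′ X′ ≡ 0ℤ) →
         Equivalent I (delete I R′)
lemma5 _ _ _ _ inst _ component no-conflict = mk⇔ sound (complete no-conflict)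
  where open Reduction inst component
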